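{- Let $\mathcal{F}$ be a finite forest without any isolated vertex. Then the non-cover complex $\mathcal{N}\mathcal{C}(\mathcal{F})$ is vertex decomposable if and only if $\mathcal{F}$ is connected and has at most two internal vertices.
   Context: An internal vertex of $\mathcal{F}$ is a vertex of degree greater than $1$. For a graph $G$, a set $S\subseteq V(G)$ is a cover if $V(G)\setminus S$ contains no two adjacent vertices; the non-cover complex $\mathcal{N}\mathcal{C}(G)$ is the simplicial complex on vertex set $V(G)$ whose simplices are the subsets of $V(G)$ that are not covers of $G$. For a simplicial complex $K$ and a vertex $v$, $\mathrm{lk}(v,K)=\{\tau\in K: v\notin\tau,\ \tau\cup\{v\}\in K\}$ and $\mathrm{del}(v,K)=\{\tau\in K: v\notin \tau\}$; $K$ is vertex decomposable if $K$ is a simplex, or $K$ has a vertex $v$ such that (i) both $\mathrm{lk}(v,K)$ and $\mathrm{del}(v,K)$ are vertex decomposable, and (ii) every facet of $\mathrm{del}(v,K)$ is a facet of $K$. -}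

module Defs where

open import Data.Nat using (ℕ; suc; _≤_; _<ᵇ_)
open import Data.Bool using (Bool; true; false)
open import Data.Fin using (Fin)
open import Data.Fin.Subset using (Subset; _∈_; _∉_; _⊆_; _∪_; ⁅_⁆; ∣_∣)
open import Data.Vec using (tabulate)
open import Data.List using (List; length; _++_; take)
open import Data.List.Relation.Unary.Unique.Propositional using (Unique)
open import Data.List.Relation.Unary.Linked using (Linked)
open import Data.Product using (Σ; _×_; ∃)
open import Data.Sum using (_⊎_)
open import Relation.Nullary using (¬_)
open import Relation.Binary.PropositionalEquality using (_≡_)
open import Function.Bundles using (_⇔_)
open import Level using () renaming (suc to lsuc; zero to lzero)

record Graph (n : ℕ) : Set where
  field
    E     : Fin n → Fin n → Bool
    sym   : ∀ u v → E u v ≡ E v u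
    irrefl : ∀ v → E v v ≡ false
open Graph public

Adj : ∀ {n} → Graph n → Fin n → Fin n → Set
Adj G u v = E G u v ≡ true

data Walk {n} (G : Graph n) : Fin n → Fin n → Set where
  []  : ∀ {u} → Walk G u u
  _∷_ : ∀ {u v w} → Adj G u v → Walk G v w → Walk G u w

Connected : ∀ {n} → Graph n → Set
Connected G = ∀ u v → Walk G u v

-- a cycle: a list of ≥ 3 distinct vertices, consecutive ones adjacent,
-- and the last adjacent to the first
HasCycle : ∀ {n} → Graph n → Set
HasCycle {n} G = Σ (List (Fin n)) λ vs →
  (3 ≤ length vs) × Unique vs × Linked (Adj G) (vs ++ take 1 vs)

IsForest : ∀ {n} → Graph n → Set
IsForest G = ¬ HasCycle G

NoIsolatedVertex : ∀ {n} → Graph n → Set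
NoIsolatedVertex G = ∀ v → ∃ λ u → Adj G v u

degree : ∀ {n} → Graph n → Fin n → ℕ
degree G v = ∣ tabulate (E G v) ∣

internalVertices : ∀ {n} → Graph n → Subset n
internalVertices G = tabulate (λ v → 1 <ᵇ degree G v)

IsCover : ∀ {n} → Graph n → Subset n → Set
IsCover G S = ∀ u v → Adj G u v → u ∈ S ⊎ v ∈ S

Complex : ℕ → Set₁
Complex n = Subset n → Set

NC : ∀ {n} → Graph n → Complex n
NC G σ = ¬ IsCover G σ

lk : ∀ {n} → Fin n → Complex n → Complex n
lk v K τ = v ∉ τ × K (τ ∪ ⁅ v ⁆)

del : ∀ {n} → Fin n → Complex n → Complex n
del v K τ = v ∉ τ × K τ

IsFacet : ∀ {n} → Complex n → Subset n → Set
IsFacet K τ = K τ × (∀ σ → K σ → τ ⊆ σ → σ ≡ τ)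

IsSimplex : ∀ {n} → Complex n → Set
IsSimplex K = Σ _ λ σ → ∀ τ → K τ ⇔ τ ⊆ σ

-- vertex decomposability; the shedding vertex v must be a vertex of K
data VertexDecomposable {n} : Complex n → Set₁ where
  simplex : ∀ {K} → IsSimplex K → VertexDecomposable K
  shed    : ∀ {K} (v : Fin n) → K ⁅ v ⁆
          → VertexDecomposable (lk v K)
          → VertexDecomposable (del v K)
          → (∀ τ → IsFacet (del v K) τ → IsFacet K τ)
          → VertexDecomposable K

-- A face whose link is the disjoint union of two simplices of positive dimension obstructs vertex
-- decomposability: the obstruction survives the link of a shedding vertex inside the face and the
-- deletion of one outside both simplices, a shedding vertex of either simplex violates the facet
-- condition, and a complex with such a face is no simplex. In NC(G) the complement of an induced 2K₂
-- is such a face, so if NC(G) is vertex decomposable then every two edges of G are joined by an edge.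
-- Without isolated vertices this makes G connected; in a forest two non-adjacent internal vertices
-- would then lie on a 4- or 5-cycle, so the internal vertices are pairwise adjacent, and there are at
-- most two of them since there is no triangle.
-- Conversely, if G is connected with at most two internal vertices, some edge uw meets every edge.
-- Unless G is that single edge (then NC(G) is a simplex), shed the end u whose partner w has a
-- further neighbour: both the link and the deletion of u in NC(G) consist of the faces of a simplex that do
-- not contain a fixed nonempty set Q, and these complexes are vertex decomposable by shedding the
-- vertices of Q one at a time.

module Submission where

open import Defs hiding (sym)
open import Data.Nat using (ℕ; zero; suc; _≤_; _<_; z≤n; s≤s; s≤s⁻¹; _≤?_)
open import Data.Nat.Properties using (≰⇒>; ≤⇒≯; ≤-trans; ≤-refl; <ᵇ⇒<; <⇒<ᵇ)
open import Data.Fin using (Fin; zero; suc)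
open import Data.Fin.Properties using (any?; _≟_)
open import Data.Fin.Subset
  using (Subset; _∈_; _∉_; _⊆_; _∪_; ∁; _-_; _─_; ⁅_⁆; ∣_∣; ⊤; Nonempty; Empty; inside; outside)
open import Data.Fin.Subset.Properties
  using (_∈?_; x∈⁅x⁆; x∈⁅y⁆⇒x≡y; x∈p∪q⁻; x∈p∪q⁺; p⊆p∪q; q⊆p∪q; x∈p∧x≢y⇒x∈p-y; x≢y⇒x∉⁅y⁆; p─q⊆p;
        p─⊥≡p; nonempty?; ⊆-trans; x∉p⇒x∈∁p; x∉∁p⇒x∈p; x∈p⇒x∉∁p; ∈⊤; ⊆⊤; ⊆-antisym; ∪-comm)
open import Data.Vec using (_∷_; here; there; tabulate)
open import Data.Vec.Properties using (lookup∘tabulate; []=⇒lookup; lookup⇒[]=)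
open import Data.Bool using (true)
open import Data.Bool.Properties using (T-≡) renaming (_≟_ to _≟ᵇ_)
open import Data.List using (List; []; _∷_; length)
open import Data.List.Relation.Unary.All as All using (All; []; _∷_)
open import Data.List.Relation.Unary.AllPairs using ([]; _∷_)
open import Data.List.Relation.Unary.Linked using ([-]; _∷_)
open import Data.List.Relation.Unary.Unique.Propositional using (Unique)
open import Data.Product as Product using (Σ; _×_; _,_; proj₁; proj₂; ∃)
open import Data.Sum as Sum using (_⊎_; inj₁; inj₂)
open import Data.Empty using (⊥-elim)
open import Function using (_∘_; id)
open import Relation.Nullary using (¬_; Dec; yes; no)
open import Relation.Nullary.Decidable using (_×-dec_; ¬?; decidable-stable)
open import Relation.Unary using (_≐_)
open import Function.Bundles using (_⇔_; mk⇔; Equivalence)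
open import Relation.Binary.PropositionalEquality using (_≡_; _≢_; refl; sym; trans; subst; cong)

private
  variable
    n : ℕ

-- Subsets of Fin n

x∈p─q⇒x∉q : ∀ (p q : Subset n) {x} → x ∈ p ─ q → x ∉ q
x∈p─q⇒x∉q (_ ∷ p) (inside  ∷ q) {zero}  ()        here
x∈p─q⇒x∉q (_ ∷ p) (outside ∷ q) {zero}  _         ()
x∈p─q⇒x∉q (_ ∷ p) (_       ∷ q) {suc x} (there m) (there m′) = x∈p─q⇒x∉q p q m m′

x∈p-y⁻ : ∀ {p : Subset n} {x y} → x ∈ p - y → x ∈ p × x ≢ y
x∈p-y⁻ {p = p} {y = y} x∈ = p─q⊆p p ⁅ y ⁆ x∈ , λ { refl → x∈p─q⇒x∉q p ⁅ y ⁆ x∈ (x∈⁅x⁆ y) }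

x∈p∪⁅y⁆⁻ : ∀ {p : Subset n} {x y} → x ∈ p ∪ ⁅ y ⁆ → x ∈ p ⊎ x ≡ y
x∈p∪⁅y⁆⁻ {p = p} {y = y} x∈ = Sum.map₂ (x∈⁅y⁆⇒x≡y y) (x∈p∪q⁻ p ⁅ y ⁆ x∈)

x∈⁅x⁆∪⁅y⁆ : ∀ {x y : Fin n} → x ∈ ⁅ x ⁆ ∪ ⁅ y ⁆
x∈⁅x⁆∪⁅y⁆ {x = x} = x∈p∪q⁺ (inj₁ (x∈⁅x⁆ x))

y∈p∪⁅y⁆ : ∀ {p : Subset n} {y} → y ∈ p ∪ ⁅ y ⁆
y∈p∪⁅y⁆ {p = p} {y} = q⊆p∪q p ⁅ y ⁆ (x∈⁅x⁆ y)

x∉p∪q : ∀ {p q : Subset n} {x} → x ∉ p → x ∉ q → x ∉ p ∪ q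
x∉p∪q {p = p} {q} x∉p x∉q = Sum.[ x∉p , x∉q ] ∘ x∈p∪q⁻ p q

x∉p∪⁅y⁆ : ∀ {p : Subset n} {x y} → x ∉ p → x ≢ y → x ∉ p ∪ ⁅ y ⁆
x∉p∪⁅y⁆ x∉p x≢y x∈ = Sum.[ x∉p , x≢y ] (x∈p∪⁅y⁆⁻ x∈)

p∪⁅x⁆⊆q : ∀ {p q : Subset n} {x} → p ⊆ q → x ∈ q → p ∪ ⁅ x ⁆ ⊆ q
p∪⁅x⁆⊆q p⊆q x∈q y∈ with x∈p∪⁅y⁆⁻ y∈
... | inj₁ y∈p = p⊆q y∈p
... | inj₂ refl = x∈q

⁅x⁆⊆p : ∀ {p : Subset n} {x} → x ∈ p → ⁅ x ⁆ ⊆ p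
⁅x⁆⊆p {x = x} x∈p y∈⁅x⁆ = subst (_∈ _) (sym (x∈⁅y⁆⇒x≡y x y∈⁅x⁆)) x∈p

p⊆q-x⁺ : ∀ {p q : Subset n} {x} → p ⊆ q → x ∉ p → p ⊆ q - x
p⊆q-x⁺ p⊆q x∉p y∈p = x∈p∧x≢y⇒x∈p-y (p⊆q y∈p) λ { refl → x∉p y∈p }

p⊆q-x⁻ : ∀ {p q : Subset n} {x} → p ⊆ q - x → p ⊆ q × x ∉ p
p⊆q-x⁻ p⊆q-x = proj₁ ∘ x∈p-y⁻ ∘ p⊆q-x , λ x∈p → proj₂ (x∈p-y⁻ (p⊆q-x x∈p)) refl

∪-monoˡ-⊆ : ∀ {p q : Subset n} r → p ⊆ q → p ∪ r ⊆ q ∪ r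
∪-monoˡ-⊆ {p = p} r p⊆q x∈ = x∈p∪q⁺ (Sum.map₁ p⊆q (x∈p∪q⁻ p r x∈))

p-x⊆q⇒p⊆q∪⁅x⁆ : ∀ {p q : Subset n} {x} → p - x ⊆ q → p ⊆ q ∪ ⁅ x ⁆
p-x⊆q⇒p⊆q∪⁅x⁆ {x = x} p-x⊆q {y} y∈p with y ≟ x
... | yes refl = y∈p∪⁅y⁆
... | no y≢x  = p⊆p∪q ⁅ x ⁆ (p-x⊆q (x∈p∧x≢y⇒x∈p-y y∈p y≢x))

q⊆p∪r⇒q⊆p-x∪r : ∀ {p q r : Subset n} {x} → x ∉ q → q ⊆ p ∪ r → q ⊆ (p - x) ∪ r
q⊆p∪r⇒q⊆p-x∪r {p = p} {r = r} x∉q q⊆p∪r y∈q =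
  x∈p∪q⁺ (Sum.map₁ (λ y∈p → x∈p∧x≢y⇒x∈p-y y∈p λ { refl → x∉q y∈q }) (x∈p∪q⁻ p r (q⊆p∪r y∈q)))

q⊆p-x∪r⇒x∉q : ∀ {p q r : Subset n} {x} → x ∉ r → q ⊆ (p - x) ∪ r → x ∉ q
q⊆p-x∪r⇒x∉q {p = p} {r = r} x∉r q⊆p-x∪r x∈q =
  Sum.[ (λ x∈p-x → proj₂ (x∈p-y⁻ x∈p-x) refl) , x∉r ] (x∈p∪q⁻ (p - _) r (q⊆p-x∪r x∈q))

q⊆p-x∪r⇒q∪⁅x⁆⊆p∪r : ∀ {p q r : Subset n} {x} → x ∈ p → q ⊆ (p - x) ∪ r → q ∪ ⁅ x ⁆ ⊆ p ∪ r
q⊆p-x∪r⇒q∪⁅x⁆⊆p∪r {r = r} x∈p q⊆p-x∪r =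
  p∪⁅x⁆⊆q (∪-monoˡ-⊆ r (proj₁ ∘ x∈p-y⁻) ∘ q⊆p-x∪r) (p⊆p∪q r x∈p)

x∈⁅y⁆∪⁅z⁆⁻ : ∀ {x y z : Fin n} → x ∈ ⁅ y ⁆ ∪ ⁅ z ⁆ → x ≡ y ⊎ x ≡ z
x∈⁅y⁆∪⁅z⁆⁻ {y = y} {z} x∈ = Sum.map (x∈⁅y⁆⇒x≡y y) (x∈⁅y⁆⇒x≡y z) (x∈p∪q⁻ ⁅ y ⁆ ⁅ z ⁆ x∈)

⁅y⁆∪⁅z⁆∩T≡∅ : ∀ {T : Subset n} {x x′ y z} → x ∈ ⁅ y ⁆ ∪ ⁅ z ⁆ → x′ ∈ ⁅ y ⁆ ∪ ⁅ z ⁆ → x ≢ x′ →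
               x ∉ T → x′ ∉ T → ∀ {w} → w ∈ ⁅ y ⁆ ∪ ⁅ z ⁆ → w ∉ T
⁅y⁆∪⁅z⁆∩T≡∅ x∈ x′∈ x≢x′ x∉T x′∉T w∈ with x∈⁅y⁆∪⁅z⁆⁻ x∈ | x∈⁅y⁆∪⁅z⁆⁻ x′∈ | x∈⁅y⁆∪⁅z⁆⁻ w∈
... | inj₁ refl | inj₁ refl | _         = ⊥-elim (x≢x′ refl)
... | inj₂ refl | inj₂ refl | _         = ⊥-elim (x≢x′ refl)
... | inj₁ refl | inj₂ refl | inj₁ refl = x∉T
... | inj₁ refl | inj₂ refl | inj₂ refl = x′∉T
... | inj₂ refl | inj₁ refl | inj₁ refl = x′∉T
... | inj₂ refl | inj₁ refl | inj₂ refl = x∉T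

T⊆∁V∪W : ∀ {T V W : Subset n} → (∀ {x} → x ∈ V → x ∈ W ⊎ x ∉ T) → T ⊆ ∁ V ∪ W
T⊆∁V∪W {V = V} V⊆W∪∁T {x} x∈T with x ∈? V
... | no x∉V = x∈p∪q⁺ (inj₁ (x∉p⇒x∈∁p x∉V))
... | yes x∈V = x∈p∪q⁺ (inj₂ (Sum.[ id , (λ x∉T → ⊥-elim (x∉T x∈T)) ] (V⊆W∪∁T x∈V)))

∣p∣≡1+∣p-x∣ : ∀ (p : Subset n) {x} → x ∈ p → ∣ p ∣ ≡ suc ∣ p - x ∣
∣p∣≡1+∣p-x∣ (inside  ∷ p) here      = cong (suc ∘ ∣_∣) (sym (p─⊥≡p p))
∣p∣≡1+∣p-x∣ (inside  ∷ p) (there m) = cong suc (∣p∣≡1+∣p-x∣ p m)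
∣p∣≡1+∣p-x∣ (outside ∷ p) (there m) = ∣p∣≡1+∣p-x∣ p m

length≤∣p∣ : ∀ {p : Subset n} {xs} → Unique xs → All (_∈ p) xs → length xs ≤ ∣ p ∣
length≤∣p∣ [] [] = z≤n
length≤∣p∣ {p = p} (x≢xs ∷ xs-unique) (x∈p ∷ xs⊆p) rewrite ∣p∣≡1+∣p-x∣ p x∈p =
  s≤s (length≤∣p∣ xs-unique (All.zipWith (λ (y∈p , x≢y) → x∈p∧x≢y⇒x∈p-y y∈p (x≢y ∘ sym)) (xs⊆p , x≢xs)))

0<∣p∣⇒Nonempty : ∀ (p : Subset n) → 0 < ∣ p ∣ → Nonempty p
0<∣p∣⇒Nonempty (inside  ∷ p) _ = zero , here
0<∣p∣⇒Nonempty (outside ∷ p) 0<∣p∣ with 0<∣p∣⇒Nonempty p 0<∣p∣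
... | x , x∈p = suc x , there x∈p

2≤∣p∣⇒Nonempty[p-x] : ∀ {p : Subset n} {x} → 2 ≤ ∣ p ∣ → x ∈ p → Nonempty (p - x)
2≤∣p∣⇒Nonempty[p-x] {p = p} 2≤∣p∣ x∈p = 0<∣p∣⇒Nonempty _ (s≤s⁻¹ (subst (2 ≤_) (∣p∣≡1+∣p-x∣ p x∈p) 2≤∣p∣))

distinctMembers : ∀ k (p : Subset n) → k ≤ ∣ p ∣ →
                  Σ (List (Fin n)) λ xs → length xs ≡ k × Unique xs × All (_∈ p) xs
distinctMembers zero    p _       = [] , refl , [] , []
distinctMembers (suc k) p 1+k≤∣p∣ with 0<∣p∣⇒Nonempty p (≤-trans (s≤s z≤n) 1+k≤∣p∣)
... | x , x∈p with distinctMembers k (p - x) (s≤s⁻¹ (subst (suc k ≤_) (∣p∣≡1+∣p-x∣ p x∈p) 1+k≤∣p∣))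
... | xs , refl , xs-unique , xs⊆p-x =
  x ∷ xs , refl , All.map (λ y∈ → proj₂ (x∈p-y⁻ y∈) ∘ sym) xs⊆p-x ∷ xs-unique
  , x∈p ∷ All.map (proj₁ ∘ x∈p-y⁻) xs⊆p-x

Empty[p-x]⇒p⊆⁅x⁆ : ∀ {p : Subset n} {x} → Empty (p - x) → p ⊆ ⁅ x ⁆
Empty[p-x]⇒p⊆⁅x⁆ {x = x} p-x-empty {z} z∈p with z ≟ x
... | yes refl = x∈⁅x⁆ z
... | no z≢x   = ⊥-elim (p-x-empty (z , x∈p∧x≢y⇒x∈p-y z∈p z≢x))

∣p∣≤2⇒⊆⁅u⁆∪⁅w⁆ : ∀ {p : Subset n} {a b} → a ≢ b → ∣ p ∣ ≤ 2 →
                  ∃ λ u → ∃ λ w → u ≢ w × p ⊆ ⁅ u ⁆ ∪ ⁅ w ⁆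
∣p∣≤2⇒⊆⁅u⁆∪⁅w⁆ {p = p} {a} {b} a≢b ∣p∣≤2 with nonempty? p
... | no p-empty = a , b , a≢b , λ {x} x∈p → ⊥-elim (p-empty (x , x∈p))
... | yes (x , x∈p) with nonempty? (p - x)
...   | no p-x-empty with x ≟ a
...     | yes refl = x , b , a≢b , p⊆p∪q ⁅ b ⁆ ∘ Empty[p-x]⇒p⊆⁅x⁆ p-x-empty
...     | no x≢a   = x , a , x≢a , p⊆p∪q ⁅ a ⁆ ∘ Empty[p-x]⇒p⊆⁅x⁆ p-x-empty
∣p∣≤2⇒⊆⁅u⁆∪⁅w⁆ {p = p} a≢b ∣p∣≤2 | yes (x , x∈p) | yes (y , y∈p-x) =
  x , y , y≢x ∘ sym , p⊆⁅x⁆∪⁅y⁆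
  where
  y∈p = proj₁ (x∈p-y⁻ y∈p-x)
  y≢x = proj₂ (x∈p-y⁻ y∈p-x)
  p⊆⁅x⁆∪⁅y⁆ : p ⊆ ⁅ x ⁆ ∪ ⁅ y ⁆
  p⊆⁅x⁆∪⁅y⁆ {z} z∈p with z ≟ x | z ≟ y
  ... | yes refl | _        = x∈⁅x⁆∪⁅y⁆
  ... | no _     | yes refl = y∈p∪⁅y⁆
  ... | no z≢x   | no z≢y   = ⊥-elim (≤⇒≯ ∣p∣≤2 (length≤∣p∣
        ((y≢x ∘ sym ∷ z≢x ∘ sym ∷ []) ∷ (z≢y ∘ sym ∷ []) ∷ [] ∷ []) (x∈p ∷ y∈p ∷ z∈p ∷ [])))

-- Simplicial complexes

Δ : Subset n → Complex n
Δ σ τ = τ ⊆ σ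

delFace : Subset n → Complex n → Complex n
delFace Q K τ = K τ × ∃ λ q → q ∈ Q × q ∉ τ

Δ-vertexDecomposable : (σ : Subset n) → VertexDecomposable (Δ σ)
Δ-vertexDecomposable σ = simplex (σ , λ τ → mk⇔ id id)

module _ {K L : Complex n} (K≐L : K ≐ L) where
  private
    K⊆L = proj₁ K≐L
    L⊆K = proj₂ K≐L

  lk-resp-≐ : ∀ v → lk v K ≐ lk v L
  lk-resp-≐ v = Product.map₂ K⊆L , Product.map₂ L⊆K

  del-resp-≐ : ∀ v → del v K ≐ del v L
  del-resp-≐ v = Product.map₂ K⊆L , Product.map₂ L⊆K

  IsFacet-resp-≐ : ∀ {τ} → IsFacet K τ → IsFacet L τ
  IsFacet-resp-≐ (Kτ , maximal) = K⊆L Kτ , λ σ Lσ → maximal σ (L⊆K Lσ)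

  IsSimplex-resp-≐ : IsSimplex K → IsSimplex L
  IsSimplex-resp-≐ (σ , K⇔Δσ) = σ , λ τ → mk⇔ (λ Lτ {x} → Equivalence.to (K⇔Δσ τ) (L⊆K Lτ) {x})
                                              (λ τ⊆σ → K⊆L (Equivalence.from (K⇔Δσ τ) (λ {x} → τ⊆σ {x})))

≐-sym : {K L : Complex n} → K ≐ L → L ≐ K
≐-sym (K⊆L , L⊆K) = L⊆K , K⊆L

VertexDecomposable-resp-≐ : {K L : Complex n} → K ≐ L → VertexDecomposable K → VertexDecomposable L
VertexDecomposable-resp-≐ K≐L (simplex isSimplex) = simplex (IsSimplex-resp-≐ K≐L isSimplex)
VertexDecomposable-resp-≐ K≐L (shed v Kv lk-vd del-vd facets) =
  shed v (proj₁ K≐L Kv)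
    (VertexDecomposable-resp-≐ (lk-resp-≐ K≐L v) lk-vd)
    (VertexDecomposable-resp-≐ (del-resp-≐ K≐L v) del-vd)
    (λ τ → IsFacet-resp-≐ K≐L ∘ facets τ ∘ IsFacet-resp-≐ (≐-sym (del-resp-≐ K≐L v)))

shedding-criterion : ∀ {K : Complex n} v →
  (∀ {τ σ} → del v K τ → K σ → τ ⊆ σ → v ∈ σ → ∃ λ z → z ∉ σ × del v K (τ ∪ ⁅ z ⁆)) →
  ∀ τ → IsFacet (del v K) τ → IsFacet K τ
shedding-criterion {K = K} v extend τ ((v∉τ , Kτ) , maximal) = Kτ , maximal′
  where
  maximal′ : ∀ σ → K σ → τ ⊆ σ → σ ≡ τ
  maximal′ σ Kσ τ⊆σ with v ∈? σ
  ... | no v∉σ = maximal σ (v∉σ , Kσ) τ⊆σ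
  ... | yes v∈σ with extend (v∉τ , Kτ) Kσ τ⊆σ v∈σ
  ... | z , z∉σ , del-τ∪z = ⊥-elim (z∉σ (τ⊆σ (subst (z ∈_) (maximal _ del-τ∪z (p⊆p∪q ⁅ z ⁆)) y∈p∪⁅y⁆)))

module _ {Q σ : Subset n} {q} (Q⊆σ : Q ⊆ σ) (q∈Q : q ∈ Q) where

  del-delFace-Δ : del q (delFace Q (Δ σ)) ≐ Δ (σ - q)
  del-delFace-Δ = (λ (q∉τ , τ⊆σ , _) → p⊆q-x⁺ τ⊆σ q∉τ)
                , (λ τ⊆σ-q → let τ⊆σ , q∉τ = p⊆q-x⁻ τ⊆σ-q in q∉τ , τ⊆σ , q , q∈Q , q∉τ)

  lk-delFace-Δ : lk q (delFace Q (Δ σ)) ≐ delFace (Q - q) (Δ (σ - q))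
  lk-delFace-Δ = (λ (q∉τ , τ∪q⊆σ , r , r∈Q , r∉τ∪q) →
                     p⊆q-x⁺ (τ∪q⊆σ ∘ p⊆p∪q ⁅ q ⁆) q∉τ
                   , r , x∈p∧x≢y⇒x∈p-y r∈Q (λ { refl → r∉τ∪q y∈p∪⁅y⁆ }) , r∉τ∪q ∘ p⊆p∪q ⁅ q ⁆)
               , (λ (τ⊆σ-q , r , r∈Q-q , r∉τ) →
                     let τ⊆σ , q∉τ = p⊆q-x⁻ τ⊆σ-q
                         r∈Q , r≢q = x∈p-y⁻ r∈Q-q
                     in q∉τ , p∪⁅x⁆⊆q τ⊆σ (Q⊆σ q∈Q) , r , r∈Q , x∉p∪⁅y⁆ r∉τ r≢q)

delFace-Δ-vertexDecomposable : ∀ {Q σ : Subset n} {q} → Q ⊆ σ → q ∈ Q →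
                               VertexDecomposable (delFace Q (Δ σ))
delFace-Δ-vertexDecomposable {Q = Q} = go ∣ Q ∣ ≤-refl
  where
  go : ∀ k {Q σ : Subset n} {q} → ∣ Q ∣ ≤ k → Q ⊆ σ → q ∈ Q → VertexDecomposable (delFace Q (Δ σ))
  go zero {Q} ∣Q∣≤0 Q⊆σ q∈Q with subst (_≤ 0) (∣p∣≡1+∣p-x∣ Q q∈Q) ∣Q∣≤0
  ... | ()
  go (suc k) {Q} {σ} {q} ∣Q∣≤1+k Q⊆σ q∈Q with any? (_∈? Q - q)
  ... | no Q⊆⁅q⁆ = VertexDecomposable-resp-≐ only-q (Δ-vertexDecomposable (σ - q))
    where
    only-q : Δ (σ - q) ≐ delFace Q (Δ σ)
    only-q = (λ τ⊆σ-q → let τ⊆σ , q∉τ = p⊆q-x⁻ τ⊆σ-q in τ⊆σ , q , q∈Q , q∉τ)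
           , (λ { (τ⊆σ , r , r∈Q , r∉τ) → p⊆q-x⁺ τ⊆σ λ q∈τ →
                    Q⊆⁅q⁆ (r , x∈p∧x≢y⇒x∈p-y r∈Q λ { refl → r∉τ q∈τ }) })
  ... | yes (q′ , q′∈Q-q) =
    shed q (⁅x⁆⊆p (Q⊆σ q∈Q) , q′ , q′∈Q , x≢y⇒x∉⁅y⁆ q′≢q)
      (VertexDecomposable-resp-≐ (≐-sym (lk-delFace-Δ Q⊆σ q∈Q))
        (go k ∣Q-q∣≤k (λ x∈Q-q → let x∈Q , x≢q = x∈p-y⁻ x∈Q-q in x∈p∧x≢y⇒x∈p-y (Q⊆σ x∈Q) x≢q) q′∈Q-q))
      (VertexDecomposable-resp-≐ (≐-sym (del-delFace-Δ Q⊆σ q∈Q)) (Δ-vertexDecomposable (σ - q)))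
      (shedding-criterion q extend)
    where
    q′∈Q = proj₁ (x∈p-y⁻ q′∈Q-q)
    q′≢q = proj₂ (x∈p-y⁻ q′∈Q-q)
    ∣Q-q∣≤k : ∣ Q - q ∣ ≤ k
    ∣Q-q∣≤k = s≤s⁻¹ (subst (_≤ suc k) (∣p∣≡1+∣p-x∣ Q q∈Q) ∣Q∣≤1+k)
    extend : ∀ {τ ρ} → del q (delFace Q (Δ σ)) τ → delFace Q (Δ σ) ρ → τ ⊆ ρ → q ∈ ρ →
             ∃ λ z → z ∉ ρ × del q (delFace Q (Δ σ)) (τ ∪ ⁅ z ⁆)
    extend (q∉τ , τ⊆σ , _) (_ , r , r∈Q , r∉ρ) τ⊆ρ q∈ρ =
      r , r∉ρ , q∉τ∪r , p∪⁅x⁆⊆q τ⊆σ (Q⊆σ r∈Q) , q , q∈Q , q∉τ∪r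
      where
      q∉τ∪r = x∉p∪⁅y⁆ q∉τ λ { refl → r∉ρ q∈ρ }

-- The link of the face τ is the disjoint union of the simplices on X and on Y.
record SplitLink (K : Complex n) : Set where
  field
    τ X Y   : Subset n
    X∉τ∪Y   : ∀ {x} → x ∈ X → x ∉ τ ∪ Y
    Y∉τ∪X   : ∀ {y} → y ∈ Y → y ∉ τ ∪ X
    2≤∣X∣   : 2 ≤ ∣ X ∣
    2≤∣Y∣   : 2 ≤ ∣ Y ∣
    face⁻   : ∀ {T} → τ ⊆ T → K T → T ⊆ τ ∪ X ⊎ T ⊆ τ ∪ Y
    face⁺   : ∀ {T} → τ ⊆ T → T ⊆ τ ∪ X ⊎ T ⊆ τ ∪ Y → K T

module _ {K : Complex n} (L : SplitLink K) where
  open SplitLink L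

  SplitLink-swap : SplitLink K
  SplitLink-swap = record
    { τ = τ ; X = Y ; Y = X ; X∉τ∪Y = Y∉τ∪X ; Y∉τ∪X = X∉τ∪Y ; 2≤∣X∣ = 2≤∣Y∣ ; 2≤∣Y∣ = 2≤∣X∣
    ; face⁻ = λ τ⊆T → Sum.swap ∘ face⁻ τ⊆T
    ; face⁺ = λ τ⊆T → face⁺ τ⊆T ∘ Sum.swap
    }

  SplitLink-lk : ∀ {v} → v ∈ τ → SplitLink (lk v K)
  SplitLink-lk {v} v∈τ = record
    { τ = τ - v ; X = X ; Y = Y
    ; X∉τ∪Y = λ x∈X → X∉τ∪Y x∈X ∘ ∪-monoˡ-⊆ Y τ-v⊆τ
    ; Y∉τ∪X = λ y∈Y → Y∉τ∪X y∈Y ∘ ∪-monoˡ-⊆ X τ-v⊆τ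
    ; 2≤∣X∣ = 2≤∣X∣ ; 2≤∣Y∣ = 2≤∣Y∣
    ; face⁻ = λ { τ-v⊆T (v∉T , K[T∪v]) → lower v∉T (face⁻ (p-x⊆q⇒p⊆q∪⁅x⁆ τ-v⊆T) K[T∪v]) }
    ; face⁺ = λ τ-v⊆T T⊆ → v∉T T⊆ , face⁺ (p-x⊆q⇒p⊆q∪⁅x⁆ τ-v⊆T) (raise T⊆)
    }
    where
    τ-v⊆τ : τ - v ⊆ τ
    τ-v⊆τ = proj₁ ∘ x∈p-y⁻
    lower : ∀ {T} → v ∉ T → T ∪ ⁅ v ⁆ ⊆ τ ∪ X ⊎ T ∪ ⁅ v ⁆ ⊆ τ ∪ Y → T ⊆ (τ - v) ∪ X ⊎ T ⊆ (τ - v) ∪ Y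
    lower v∉T (inj₁ T∪v⊆) = inj₁ (q⊆p∪r⇒q⊆p-x∪r v∉T (⊆-trans (p⊆p∪q ⁅ v ⁆) T∪v⊆))
    lower v∉T (inj₂ T∪v⊆) = inj₂ (q⊆p∪r⇒q⊆p-x∪r v∉T (⊆-trans (p⊆p∪q ⁅ v ⁆) T∪v⊆))
    raise : ∀ {T} → T ⊆ (τ - v) ∪ X ⊎ T ⊆ (τ - v) ∪ Y → T ∪ ⁅ v ⁆ ⊆ τ ∪ X ⊎ T ∪ ⁅ v ⁆ ⊆ τ ∪ Y
    raise (inj₁ T⊆) = inj₁ (q⊆p-x∪r⇒q∪⁅x⁆⊆p∪r v∈τ T⊆)
    raise (inj₂ T⊆) = inj₂ (q⊆p-x∪r⇒q∪⁅x⁆⊆p∪r v∈τ T⊆)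
    v∉T : ∀ {T} → T ⊆ (τ - v) ∪ X ⊎ T ⊆ (τ - v) ∪ Y → v ∉ T
    v∉T (inj₁ T⊆) = q⊆p-x∪r⇒x∉q (λ v∈X → X∉τ∪Y v∈X (p⊆p∪q Y v∈τ)) T⊆
    v∉T (inj₂ T⊆) = q⊆p-x∪r⇒x∉q (λ v∈Y → Y∉τ∪X v∈Y (p⊆p∪q X v∈τ)) T⊆

  SplitLink-¬IsSimplex : ¬ IsSimplex K
  SplitLink-¬IsSimplex (σ , K⇔Δσ)
    with 0<∣p∣⇒Nonempty X (≤-trans (s≤s z≤n) 2≤∣X∣) | 0<∣p∣⇒Nonempty Y (≤-trans (s≤s z≤n) 2≤∣Y∣)
  ... | x , x∈X | y , y∈Y with face⁻ τ⊆T (Equivalence.from (K⇔Δσ T) (λ {z} → T⊆σ {z}))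
    where
    T = (τ ∪ ⁅ x ⁆) ∪ ⁅ y ⁆
    τ⊆T : τ ⊆ T
    τ⊆T = ⊆-trans (p⊆p∪q ⁅ x ⁆) (p⊆p∪q ⁅ y ⁆)
    face⊆σ : ∀ {Z} → K (τ ∪ Z) → τ ∪ Z ⊆ σ
    face⊆σ Kτ∪Z {z} = Equivalence.to (K⇔Δσ _) Kτ∪Z {z}
    τ∪X⊆σ : τ ∪ X ⊆ σ
    τ∪X⊆σ = face⊆σ (face⁺ (p⊆p∪q X) (inj₁ id))
    τ∪Y⊆σ : τ ∪ Y ⊆ σ
    τ∪Y⊆σ = face⊆σ (face⁺ (p⊆p∪q Y) (inj₂ id))
    T⊆σ : T ⊆ σ
    T⊆σ = p∪⁅x⁆⊆q (p∪⁅x⁆⊆q (⊆-trans (p⊆p∪q X) τ∪X⊆σ) (τ∪X⊆σ (q⊆p∪q τ X x∈X))) (τ∪Y⊆σ (q⊆p∪q τ Y y∈Y))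
  ... | inj₁ T⊆τ∪X = Y∉τ∪X y∈Y (T⊆τ∪X y∈p∪⁅y⁆)
  ... | inj₂ T⊆τ∪Y = X∉τ∪Y x∈X (T⊆τ∪Y (p⊆p∪q ⁅ y ⁆ y∈p∪⁅y⁆))

  SplitLink-¬shedding : ∀ {v} → v ∈ X → ¬ (∀ σ → IsFacet (del v K) σ → IsFacet K σ)
  SplitLink-¬shedding {v} v∈X facets = v∉B (subst (v ∈_) τ∪X≡B (q⊆p∪q τ X v∈X))
    where
    B = (τ ∪ X) - v
    v∉B : v ∉ B
    v∉B v∈B = proj₂ (x∈p-y⁻ v∈B) refl
    B⊆τ∪X : B ⊆ τ ∪ X
    B⊆τ∪X = proj₁ ∘ x∈p-y⁻
    τ⊆B : τ ⊆ B
    τ⊆B = p⊆q-x⁺ (p⊆p∪q X) (X∉τ∪Y v∈X ∘ p⊆p∪q Y)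
    maximal : ∀ σ → del v K σ → B ⊆ σ → σ ≡ B
    maximal σ (v∉σ , Kσ) B⊆σ with face⁻ (⊆-trans τ⊆B B⊆σ) Kσ
    ... | inj₁ σ⊆τ∪X = ⊆-antisym (p⊆q-x⁺ σ⊆τ∪X v∉σ) B⊆σ
    ... | inj₂ σ⊆τ∪Y with 2≤∣p∣⇒Nonempty[p-x] 2≤∣X∣ v∈X
    ...   | x′ , x′∈X-v = ⊥-elim (X∉τ∪Y x′∈X (σ⊆τ∪Y (B⊆σ x′∈B)))
      where
      x′∈X = proj₁ (x∈p-y⁻ x′∈X-v)
      x′∈B = x∈p∧x≢y⇒x∈p-y (q⊆p∪q τ X x′∈X) (proj₂ (x∈p-y⁻ x′∈X-v))
    τ∪X≡B : τ ∪ X ≡ B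
    τ∪X≡B = proj₂ (facets B ((v∉B , face⁺ τ⊆B (inj₁ B⊆τ∪X)) , maximal))
                  (τ ∪ X) (face⁺ (p⊆p∪q X) (inj₁ id)) B⊆τ∪X

  SplitLink-del : ∀ {v} → v ∉ τ ∪ X → v ∉ τ ∪ Y → SplitLink (del v K)
  SplitLink-del {v} v∉τ∪X v∉τ∪Y = record
    { τ = τ ; X = X ; Y = Y ; X∉τ∪Y = X∉τ∪Y ; Y∉τ∪X = Y∉τ∪X ; 2≤∣X∣ = 2≤∣X∣ ; 2≤∣Y∣ = 2≤∣Y∣
    ; face⁻ = λ τ⊆T → face⁻ τ⊆T ∘ proj₂
    ; face⁺ = λ τ⊆T T⊆ → v∉T T⊆ , face⁺ τ⊆T T⊆
    }
    where
    v∉T : ∀ {T} → T ⊆ τ ∪ X ⊎ T ⊆ τ ∪ Y → v ∉ T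
    v∉T (inj₁ T⊆τ∪X) = v∉τ∪X ∘ T⊆τ∪X
    v∉T (inj₂ T⊆τ∪Y) = v∉τ∪Y ∘ T⊆τ∪Y

VertexDecomposable⇒¬SplitLink : ∀ {K : Complex n} → VertexDecomposable K → ¬ SplitLink K
VertexDecomposable⇒¬SplitLink (simplex isSimplex) L = SplitLink-¬IsSimplex L isSimplex
VertexDecomposable⇒¬SplitLink (shed v _ lk-vd del-vd facets) L
  with v ∈? SplitLink.τ L | v ∈? SplitLink.X L | v ∈? SplitLink.Y L
... | yes v∈τ | _       | _       = VertexDecomposable⇒¬SplitLink lk-vd (SplitLink-lk L v∈τ)
... | no _    | yes v∈X | _       = SplitLink-¬shedding L v∈X facets
... | no _    | no _    | yes v∈Y = SplitLink-¬shedding (SplitLink-swap L) v∈Y facets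
... | no v∉τ  | no v∉X  | no v∉Y  =
  VertexDecomposable⇒¬SplitLink del-vd (SplitLink-del L (x∉p∪q v∉τ v∉X) (x∉p∪q v∉τ v∉Y))

-- Graphs and their non-cover complexes

module _ (G : Graph n) where

  Adj-sym : ∀ {u v} → Adj G u v → Adj G v u
  Adj-sym {u} {v} u~v = trans (Graph.sym G v u) u~v

  Adj⇒≢ : ∀ {u v} → Adj G u v → u ≢ v
  Adj⇒≢ {u} u~v refl with trans (sym u~v) (Graph.irrefl G u)
  ... | ()

  Adj? : ∀ u v → Dec (Adj G u v)
  Adj? u v = E G u v ≟ᵇ true

  neighbours : Fin n → Subset n
  neighbours v = tabulate (E G v)

  ∈neighbours⁺ : ∀ {v x} → Adj G v x → x ∈ neighbours v
  ∈neighbours⁺ {v} {x} v~x = lookup⇒[]= x (neighbours v) (trans (lookup∘tabulate (E G v) x) v~x)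

  ∈neighbours⁻ : ∀ {v x} → x ∈ neighbours v → Adj G v x
  ∈neighbours⁻ {v} {x} x∈N = trans (sym (lookup∘tabulate (E G v) x)) ([]=⇒lookup x∈N)

  internal⇔2≤degree : ∀ {v} → v ∈ internalVertices G ⇔ 2 ≤ degree G v
  internal⇔2≤degree {v} = mk⇔
    (λ v∈I → <ᵇ⇒< 1 (degree G v) (Equivalence.from T-≡ (trans (sym (lookup∘tabulate _ v)) ([]=⇒lookup v∈I))))
    (λ 2≤deg → lookup⇒[]= v _ (trans (lookup∘tabulate _ v) (Equivalence.to T-≡ (<⇒<ᵇ 2≤deg))))

  internal⁻ : ∀ {v} → v ∈ internalVertices G → ∃ λ y → ∃ λ z → Adj G v y × Adj G v z × y ≢ z
  internal⁻ v∈I with distinctMembers 2 _ (Equivalence.to internal⇔2≤degree v∈I)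
  ... | y ∷ z ∷ [] , refl , (y≢z ∷ []) ∷ _ , y∈N ∷ z∈N ∷ [] =
    y , z , ∈neighbours⁻ y∈N , ∈neighbours⁻ z∈N , y≢z

  internal⁺ : ∀ {v y z} → Adj G v y → Adj G v z → y ≢ z → v ∈ internalVertices G
  internal⁺ v~y v~z y≢z = Equivalence.from internal⇔2≤degree
    (length≤∣p∣ ((y≢z ∷ []) ∷ [] ∷ []) (∈neighbours⁺ v~y ∷ ∈neighbours⁺ v~z ∷ []))

  UncoveredEdge : Subset n → Set
  UncoveredEdge S = ∃ λ a → ∃ λ b → Adj G a b × a ∉ S × b ∉ S

  NC⇒UncoveredEdge : ∀ {S} → NC G S → UncoveredEdge S
  NC⇒UncoveredEdge {S} ¬cover with any? (λ a → any? λ b → Adj? a b ×-dec ¬? (a ∈? S) ×-dec ¬? (b ∈? S))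
  ... | yes uncovered = uncovered
  ... | no none = ⊥-elim (¬cover cover)
    where
    cover : IsCover G S
    cover a b a~b with a ∈? S | b ∈? S
    ... | yes a∈S | _       = inj₁ a∈S
    ... | no _    | yes b∈S = inj₂ b∈S
    ... | no a∉S  | no b∉S  = ⊥-elim (none (a , b , a~b , a∉S , b∉S))

  UncoveredEdge⇒NC : ∀ {S} → UncoveredEdge S → NC G S
  UncoveredEdge⇒NC (a , b , a~b , a∉S , b∉S) cover = Sum.[ a∉S , b∉S ] (cover a b a~b)

  2K₂Free : Set
  2K₂Free = ∀ {p q r s} → Adj G p q → Adj G r s → Adj G p r ⊎ Adj G p s ⊎ Adj G q r ⊎ Adj G q s

  induced2K₂⇒SplitLink : ∀ {p q r s} → Adj G p q → Adj G r s →
    (∀ {x y} → x ∈ ⁅ p ⁆ ∪ ⁅ q ⁆ → y ∈ ⁅ r ⁆ ∪ ⁅ s ⁆ → ¬ Adj G x y) → SplitLink (NC G)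
  induced2K₂⇒SplitLink {p} {q} {r} {s} p~q r~s no-cross = record
    { τ = τ ; X = X ; Y = Y ; X∉τ∪Y = X∉τ∪Y ; Y∉τ∪X = Y∉τ∪X ; 2≤∣X∣ = 2≤∣edge∣ p~q ; 2≤∣Y∣ = 2≤∣edge∣ r~s
    ; face⁻ = λ τ⊆T → face⁻ τ⊆T ∘ NC⇒UncoveredEdge
    ; face⁺ = λ _ → Sum.[ (λ T⊆τ∪X → UncoveredEdge⇒NC (r , s , r~s , Y∉τ∪X r∈Y ∘ T⊆τ∪X , Y∉τ∪X s∈Y ∘ T⊆τ∪X))
                        , (λ T⊆τ∪Y → UncoveredEdge⇒NC (p , q , p~q , X∉τ∪Y p∈X ∘ T⊆τ∪Y , X∉τ∪Y q∈X ∘ T⊆τ∪Y)) ]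
    }
    where
    X = ⁅ p ⁆ ∪ ⁅ q ⁆
    Y = ⁅ r ⁆ ∪ ⁅ s ⁆
    τ = ∁ (X ∪ Y)
    p∈X = x∈⁅x⁆∪⁅y⁆
    q∈X = y∈p∪⁅y⁆
    r∈Y = x∈⁅x⁆∪⁅y⁆
    s∈Y = y∈p∪⁅y⁆
    2≤∣edge∣ : ∀ {a b} → Adj G a b → 2 ≤ ∣ ⁅ a ⁆ ∪ ⁅ b ⁆ ∣
    2≤∣edge∣ a~b = length≤∣p∣ ((Adj⇒≢ a~b ∷ []) ∷ [] ∷ []) (x∈⁅x⁆∪⁅y⁆ ∷ y∈p∪⁅y⁆ ∷ [])
    X∩Y≡∅ : ∀ {z} → z ∈ X → z ∉ Y
    X∩Y≡∅ z∈X z∈Y with x∈⁅y⁆∪⁅z⁆⁻ z∈X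
    ... | inj₁ refl = no-cross q∈X z∈Y (Adj-sym p~q)
    ... | inj₂ refl = no-cross p∈X z∈Y p~q
    X∉τ∪Y : ∀ {x} → x ∈ X → x ∉ τ ∪ Y
    X∉τ∪Y x∈X = x∉p∪q (x∈p⇒x∉∁p (p⊆p∪q Y x∈X)) (X∩Y≡∅ x∈X)
    Y∉τ∪X : ∀ {y} → y ∈ Y → y ∉ τ ∪ X
    Y∉τ∪X y∈Y = x∉p∪q (x∈p⇒x∉∁p (q⊆p∪q X Y y∈Y)) (λ y∈X → X∩Y≡∅ y∈X y∈Y)
    face⁻ : ∀ {T} → τ ⊆ T → UncoveredEdge T → T ⊆ τ ∪ X ⊎ T ⊆ τ ∪ Y
    face⁻ τ⊆T (a , b , a~b , a∉T , b∉T)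
      with x∈p∪q⁻ X Y (x∉∁p⇒x∈p (a∉T ∘ τ⊆T)) | x∈p∪q⁻ X Y (x∉∁p⇒x∈p (b∉T ∘ τ⊆T))
    ... | inj₁ a∈X | inj₁ b∈X =
      inj₂ (T⊆∁V∪W (Sum.[ inj₂ ∘ ⁅y⁆∪⁅z⁆∩T≡∅ a∈X b∈X (Adj⇒≢ a~b) a∉T b∉T , inj₁ ] ∘ x∈p∪q⁻ X Y))
    ... | inj₁ a∈X | inj₂ b∈Y = ⊥-elim (no-cross a∈X b∈Y a~b)
    ... | inj₂ a∈Y | inj₁ b∈X = ⊥-elim (no-cross b∈X a∈Y (Adj-sym a~b))
    ... | inj₂ a∈Y | inj₂ b∈Y =
      inj₁ (T⊆∁V∪W (Sum.[ inj₁ , inj₂ ∘ ⁅y⁆∪⁅z⁆∩T≡∅ a∈Y b∈Y (Adj⇒≢ a~b) a∉T b∉T ] ∘ x∈p∪q⁻ X Y))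

  VertexDecomposable⇒2K₂Free : VertexDecomposable (NC G) → 2K₂Free
  VertexDecomposable⇒2K₂Free vd {p} {q} {r} {s} p~q r~s with Adj? p r | Adj? p s | Adj? q r | Adj? q s
  ... | yes p~r | _       | _       | _       = inj₁ p~r
  ... | no _    | yes p~s | _       | _       = inj₂ (inj₁ p~s)
  ... | no _    | no _    | yes q~r | _       = inj₂ (inj₂ (inj₁ q~r))
  ... | no _    | no _    | no _    | yes q~s = inj₂ (inj₂ (inj₂ q~s))
  ... | no p≁r  | no p≁s  | no q≁r  | no q≁s  =
    ⊥-elim (VertexDecomposable⇒¬SplitLink vd (induced2K₂⇒SplitLink p~q r~s no-cross))
    where
    no-cross : ∀ {x y} → x ∈ ⁅ p ⁆ ∪ ⁅ q ⁆ → y ∈ ⁅ r ⁆ ∪ ⁅ s ⁆ → ¬ Adj G x y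
    no-cross x∈ y∈ with x∈⁅y⁆∪⁅z⁆⁻ x∈ | x∈⁅y⁆∪⁅z⁆⁻ y∈
    ... | inj₁ refl | inj₁ refl = p≁r
    ... | inj₁ refl | inj₂ refl = p≁s
    ... | inj₂ refl | inj₁ refl = q≁r
    ... | inj₂ refl | inj₂ refl = q≁s

  2K₂Free⇒Connected : 2K₂Free → NoIsolatedVertex G → Connected G
  2K₂Free⇒Connected free no-isolated x y with no-isolated x | no-isolated y
  ... | x′ , x~x′ | y′ , y~y′ with free x~x′ y~y′
  ... | inj₁ x~y               = x~y ∷ []
  ... | inj₂ (inj₁ x~y′)       = x~y′ ∷ Adj-sym y~y′ ∷ []
  ... | inj₂ (inj₂ (inj₁ x′~y)) = x~x′ ∷ x′~y ∷ []
  ... | inj₂ (inj₂ (inj₂ x′~y′)) = x~x′ ∷ x′~y′ ∷ Adj-sym y~y′ ∷ []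

  module _ (forest : IsForest G) where

    ¬triangle : ∀ {a b c} → Adj G a b → Adj G b c → ¬ Adj G c a
    ¬triangle {a} {b} {c} a~b b~c c~a = forest
      ( a ∷ b ∷ c ∷ [] , s≤s (s≤s (s≤s z≤n))
      , ((Adj⇒≢ a~b ∷ Adj⇒≢ c~a ∘ sym ∷ []) ∷ (Adj⇒≢ b~c ∷ []) ∷ [] ∷ [])
      , a~b ∷ b~c ∷ c~a ∷ [-])

    commonNeighbour-unique : ∀ {a b c d} → a ≢ c → Adj G a b → Adj G b c → Adj G a d → Adj G d c → b ≡ d
    commonNeighbour-unique {a} {b} {c} {d} a≢c a~b b~c a~d d~c with b ≟ d
    ... | yes b≡d = b≡d
    ... | no b≢d  = ⊥-elim (forest
      ( a ∷ b ∷ c ∷ d ∷ [] , s≤s (s≤s (s≤s z≤n))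
      , ((Adj⇒≢ a~b ∷ a≢c ∷ Adj⇒≢ a~d ∷ []) ∷ (Adj⇒≢ b~c ∷ b≢d ∷ []) ∷ (Adj⇒≢ d~c ∘ sym ∷ []) ∷ [] ∷ [])
      , a~b ∷ b~c ∷ Adj-sym d~c ∷ Adj-sym a~d ∷ [-]))

    ¬pentagon : ∀ {a b c d e} → Adj G a b → Adj G b c → Adj G c d → Adj G d e → ¬ Adj G e a
    ¬pentagon {a} {b} {c} {d} {e} a~b b~c c~d d~e e~a = forest
      ( a ∷ b ∷ c ∷ d ∷ e ∷ [] , s≤s (s≤s (s≤s z≤n))
      , ( (Adj⇒≢ a~b ∷ a≢c ∷ a≢d ∷ Adj⇒≢ e~a ∘ sym ∷ []) ∷ (Adj⇒≢ b~c ∷ b≢d ∷ b≢e ∷ [])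
        ∷ (Adj⇒≢ c~d ∷ c≢e ∷ []) ∷ (Adj⇒≢ d~e ∷ []) ∷ [] ∷ [])
      , a~b ∷ b~c ∷ c~d ∷ d~e ∷ e~a ∷ [-])
      where
      -- Identifying two vertices at distance two closes a triangle on the other three.
      a≢c : a ≢ c
      a≢c refl = ¬triangle c~d d~e e~a
      a≢d : a ≢ d
      a≢d refl = ¬triangle a~b b~c c~d
      b≢d : b ≢ d
      b≢d refl = ¬triangle d~e e~a a~b
      b≢e : b ≢ e
      b≢e refl = ¬triangle b~c c~d d~e
      c≢e : c ≢ e
      c≢e refl = ¬triangle e~a a~b b~c

    internal⇒neighbourNotAdjacentTo : ∀ {i j} → i ∈ internalVertices G → i ≢ j →
      ∃ λ i′ → ∃ λ i″ → Adj G i i′ × Adj G i i″ × i′ ≢ i″ × ¬ Adj G i′ j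
    internal⇒neighbourNotAdjacentTo {j = j} i∈I i≢j with internal⁻ i∈I
    ... | y , z , i~y , i~z , y≢z with Adj? y j | Adj? z j
    ... | no y≁j  | _       = y , z , i~y , i~z , y≢z , y≁j
    ... | yes _   | no z≁j  = z , y , i~z , i~y , y≢z ∘ sym , z≁j
    ... | yes y~j | yes z~j = ⊥-elim (y≢z (commonNeighbour-unique i≢j i~y y~j i~z z~j))

    2K₂Free⇒internal-adjacent : 2K₂Free → ∀ {i j} → i ∈ internalVertices G → j ∈ internalVertices G →
                                i ≢ j → Adj G i j
    2K₂Free⇒internal-adjacent free {i} {j} i∈I j∈I i≢j with Adj? i j
    ... | yes i~j = i~j
    ... | no i≁j
      with internal⇒neighbourNotAdjacentTo i∈I i≢j | internal⇒neighbourNotAdjacentTo j∈I (i≢j ∘ sym)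
    ... | i′ , i″ , i~i′ , i~i″ , i′≢i″ , i′≁j | j′ , _ , j~j′ , _ , _ , j′≁i with free i~i′ j~j′
    ... | inj₁ i~j                = ⊥-elim (i≁j i~j)
    ... | inj₂ (inj₁ i~j′)        = ⊥-elim (j′≁i (Adj-sym i~j′))
    ... | inj₂ (inj₂ (inj₁ i′~j)) = ⊥-elim (i′≁j i′~j)
    ... | inj₂ (inj₂ (inj₂ i′~j′)) with free i~i″ j~j′
    ... | inj₁ i~j                 = ⊥-elim (i≁j i~j)
    ... | inj₂ (inj₁ i~j′)         = ⊥-elim (j′≁i (Adj-sym i~j′))
    ... | inj₂ (inj₂ (inj₁ i″~j))  = ⊥-elim (¬pentagon i~i″ i″~j j~j′ (Adj-sym i′~j′) (Adj-sym i~i′))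
    ... | inj₂ (inj₂ (inj₂ i″~j′)) =
      ⊥-elim (i′≢i″ (commonNeighbour-unique (λ { refl → i≁j (Adj-sym j~j′) }) i~i′ i′~j′ i~i″ i″~j′))

    2K₂Free⇒∣internalVertices∣≤2 : 2K₂Free → ∣ internalVertices G ∣ ≤ 2
    2K₂Free⇒∣internalVertices∣≤2 free with ∣ internalVertices G ∣ ≤? 2
    ... | yes ∣I∣≤2 = ∣I∣≤2
    ... | no ∣I∣≰2 with distinctMembers 3 _ (≰⇒> ∣I∣≰2)
    ... | x ∷ y ∷ z ∷ [] , refl , (x≢y ∷ x≢z ∷ []) ∷ (y≢z ∷ []) ∷ _ , x∈I ∷ y∈I ∷ z∈I ∷ [] =
      ⊥-elim (¬triangle (adjacent x∈I y∈I x≢y) (adjacent y∈I z∈I y≢z) (adjacent z∈I x∈I (x≢z ∘ sym)))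
      where adjacent = 2K₂Free⇒internal-adjacent free

  Walk-preserves : (P : Fin n → Set) → (∀ {x y} → P x → Adj G x y → P y) → ∀ {s t} → P s → Walk G s t → P t
  Walk-preserves P closed Ps []          = Ps
  Walk-preserves P closed Ps (s~x ∷ walk) = Walk-preserves P closed (closed Ps s~x) walk

  leaf-neighbour-unique : ∀ {v y z} → v ∉ internalVertices G → Adj G v y → Adj G v z → y ≡ z
  leaf-neighbour-unique {y = y} {z} v∉I v~y v~z with y ≟ z
  ... | yes y≡z = y≡z
  ... | no y≢z  = ⊥-elim (v∉I (internal⁺ v~y v~z y≢z))

  -- An edge between two leaves would be a component, and it misses u.
  internal⊆S⇒IsCover : ∀ {S u} → Connected G → internalVertices G ⊆ S → u ∈ S → IsCover G S
  internal⊆S⇒IsCover {S} {u} connected I⊆S u∈S a b a~b with a ∈? S | b ∈? S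
  ... | yes a∈S | _       = inj₁ a∈S
  ... | no _    | yes b∈S = inj₂ b∈S
  ... | no a∉S  | no b∉S  =
    ⊥-elim (Sum.[ (λ { refl → a∉S u∈S }) , (λ { refl → b∉S u∈S }) ]
                 (Walk-preserves P closed (inj₁ refl) (connected a u)))
    where
    P : Fin n → Set
    P x = x ≡ a ⊎ x ≡ b
    closed : ∀ {x y} → P x → Adj G x y → P y
    closed (inj₁ refl) x~y = inj₂ (leaf-neighbour-unique (a∉S ∘ I⊆S) x~y a~b)
    closed (inj₂ refl) x~y = inj₁ (leaf-neighbour-unique (b∉S ∘ I⊆S) x~y (Adj-sym a~b))

  -- Otherwise the component of u would be the star u ∪ neighbours u, which misses w.
  internal⊆⁅u⁆∪⁅w⁆⇒Adj : ∀ {u w} → Connected G → internalVertices G ⊆ ⁅ u ⁆ ∪ ⁅ w ⁆ → u ≢ w → Adj G u w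
  internal⊆⁅u⁆∪⁅w⁆⇒Adj {u} {w} connected I⊆uw u≢w with Adj? u w
  ... | yes u~w = u~w
  ... | no u≁w  = ⊥-elim (Sum.[ u≢w ∘ sym , u≁w ] (Walk-preserves P closed (inj₁ refl) (connected u w)))
    where
    P : Fin n → Set
    P x = x ≡ u ⊎ Adj G u x
    closed : ∀ {x y} → P x → Adj G x y → P y
    closed (inj₁ refl) x~y = inj₂ x~y
    closed {x} {y} (inj₂ u~x) x~y with y ≟ u
    ... | yes y≡u = inj₁ y≡u
    ... | no y≢u with x∈⁅y⁆∪⁅z⁆⁻ (I⊆uw (internal⁺ (Adj-sym u~x) x~y (y≢u ∘ sym)))
    ...   | inj₁ refl = ⊥-elim (Adj⇒≢ u~x refl)
    ...   | inj₂ refl = ⊥-elim (u≁w u~x)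

  ∣internalVertices∣≤2⇒coveringEdge : Connected G → NoIsolatedVertex G → ∣ internalVertices G ∣ ≤ 2 → Fin n →
                                      ∃ λ u → ∃ λ w → Adj G u w × IsCover G (⁅ u ⁆ ∪ ⁅ w ⁆)
  ∣internalVertices∣≤2⇒coveringEdge connected no-isolated ∣I∣≤2 v with no-isolated v
  ... | v′ , v~v′ with ∣p∣≤2⇒⊆⁅u⁆∪⁅w⁆ (Adj⇒≢ v~v′) ∣I∣≤2
  ... | u , w , u≢w , I⊆uw =
    u , w , internal⊆⁅u⁆∪⁅w⁆⇒Adj connected I⊆uw u≢w , internal⊆S⇒IsCover connected I⊆uw x∈⁅x⁆∪⁅y⁆

  module _ {u w} (u~w : Adj G u w) (cover : IsCover G (⁅ u ⁆ ∪ ⁅ w ⁆)) where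

    private
      w≢u : w ≢ u
      w≢u = Adj⇒≢ u~w ∘ sym

    UncoveredEdge[τ∪⁅u⁆]⁻ : ∀ {τ} → UncoveredEdge (τ ∪ ⁅ u ⁆) → w ∉ τ × ∃ λ z → z ∈ neighbours w - u × z ∉ τ
    UncoveredEdge[τ∪⁅u⁆]⁻ {τ} (a , b , a~b , a∉ , b∉) =
      Sum.[ (λ a∈uw → at-w a∈uw a~b a∉ b∉) , (λ b∈uw → at-w b∈uw (Adj-sym a~b) b∉ a∉) ] (cover a b a~b)
      where
      at-w : ∀ {x y} → x ∈ ⁅ u ⁆ ∪ ⁅ w ⁆ → Adj G x y → x ∉ τ ∪ ⁅ u ⁆ → y ∉ τ ∪ ⁅ u ⁆ →
             w ∉ τ × ∃ λ z → z ∈ neighbours w - u × z ∉ τ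
      at-w x∈uw x~y x∉ y∉ with x∈⁅y⁆∪⁅z⁆⁻ x∈uw
      ... | inj₁ refl = ⊥-elim (x∉ y∈p∪⁅y⁆)
      ... | inj₂ refl = x∉ ∘ p⊆p∪q ⁅ u ⁆
                      , _ , x∈p∧x≢y⇒x∈p-y (∈neighbours⁺ x~y) (λ { refl → y∉ y∈p∪⁅y⁆ }) , y∉ ∘ p⊆p∪q ⁅ u ⁆

    lk-u-NC : lk u (NC G) ≐ delFace (neighbours w - u) (Δ (⊤ - u - w))
    lk-u-NC =
        (λ (u∉τ , nc) → let w∉τ , avoided-neighbour = UncoveredEdge[τ∪⁅u⁆]⁻ (NC⇒UncoveredEdge nc)
                        in p⊆q-x⁺ (p⊆q-x⁺ ⊆⊤ u∉τ) w∉τ , avoided-neighbour)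
      , (λ (τ⊆⊤-u-w , z , z∈N[w]-u , z∉τ) →
           let τ⊆⊤-u , w∉τ = p⊆q-x⁻ τ⊆⊤-u-w
               z∈N[w] , z≢u = x∈p-y⁻ z∈N[w]-u
           in proj₂ (p⊆q-x⁻ τ⊆⊤-u)
            , UncoveredEdge⇒NC (w , z , ∈neighbours⁻ z∈N[w] , x∉p∪⁅y⁆ w∉τ w≢u , x∉p∪⁅y⁆ z∉τ z≢u))

    del-u-NC : del u (NC G) ≐ delFace (neighbours u) (Δ (⊤ - u))
    del-u-NC =
        (λ (u∉τ , nc) → p⊆q-x⁺ ⊆⊤ u∉τ , avoided-neighbour u∉τ (NC⇒UncoveredEdge nc))
      , (λ (τ⊆⊤-u , z , z∈N[u] , z∉τ) →
           let u∉τ = proj₂ (p⊆q-x⁻ τ⊆⊤-u)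
           in u∉τ , UncoveredEdge⇒NC (u , z , ∈neighbours⁻ z∈N[u] , u∉τ , z∉τ))
      where
      avoided-neighbour : ∀ {τ} → u ∉ τ → UncoveredEdge τ → ∃ λ z → z ∈ neighbours u × z ∉ τ
      avoided-neighbour u∉τ (a , b , a~b , a∉τ , b∉τ) with a ≟ u | b ≟ u
      ... | yes refl | _        = b , ∈neighbours⁺ a~b , b∉τ
      ... | no _     | yes refl = a , ∈neighbours⁺ (Adj-sym a~b) , a∉τ
      ... | no a≢u   | no b≢u   =
        w , ∈neighbours⁺ u~w , proj₁ (UncoveredEdge[τ∪⁅u⁆]⁻ (a , b , a~b , x∉p∪⁅y⁆ a∉τ a≢u , x∉p∪⁅y⁆ b∉τ b≢u))

    extend-at-w : ∀ {τ σ} → del u (NC G) τ → NC G σ → τ ⊆ σ → u ∈ σ → ∃ λ z → z ∉ σ × del u (NC G) (τ ∪ ⁅ z ⁆)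
    extend-at-w {τ} {σ} (u∉τ , _) ncσ τ⊆σ u∈σ with NC⇒UncoveredEdge ncσ
    ... | a , b , a~b , a∉σ , b∉σ
      with UncoveredEdge[τ∪⁅u⁆]⁻
             (a , b , a~b , x∉p∪⁅y⁆ a∉σ (λ { refl → a∉σ u∈σ }) , x∉p∪⁅y⁆ b∉σ (λ { refl → b∉σ u∈σ }))
    ... | w∉σ , z , z∈N[w]-u , z∉σ = z , z∉σ , u∉τ∪z , UncoveredEdge⇒NC (u , w , u~w , u∉τ∪z , w∉τ∪z)
      where
      u∉τ∪z = x∉p∪⁅y⁆ u∉τ (proj₂ (x∈p-y⁻ z∈N[w]-u) ∘ sym)
      w∉τ∪z = x∉p∪⁅y⁆ (w∉σ ∘ τ⊆σ) (Adj⇒≢ (∈neighbours⁻ (proj₁ (x∈p-y⁻ z∈N[w]-u))))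

    shed-u-vertexDecomposable : ∀ {y} → Adj G w y → y ≢ u → VertexDecomposable (NC G)
    shed-u-vertexDecomposable {y} w~y y≢u =
      shed u (UncoveredEdge⇒NC (w , y , w~y , x≢y⇒x∉⁅y⁆ w≢u , x≢y⇒x∉⁅y⁆ y≢u))
        (VertexDecomposable-resp-≐ (≐-sym lk-u-NC)
          (delFace-Δ-vertexDecomposable N[w]-u⊆⊤-u-w (x∈p∧x≢y⇒x∈p-y (∈neighbours⁺ w~y) y≢u)))
        (VertexDecomposable-resp-≐ (≐-sym del-u-NC)
          (delFace-Δ-vertexDecomposable N[u]⊆⊤-u (∈neighbours⁺ u~w)))
        (shedding-criterion u extend-at-w)
      where
      N[w]-u⊆⊤-u-w : neighbours w - u ⊆ ⊤ - u - w
      N[w]-u⊆⊤-u-w z∈ = let z∈N[w] , z≢u = x∈p-y⁻ z∈ in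
        x∈p∧x≢y⇒x∈p-y (x∈p∧x≢y⇒x∈p-y ∈⊤ z≢u) (Adj⇒≢ (∈neighbours⁻ z∈N[w]) ∘ sym)
      N[u]⊆⊤-u : neighbours u ⊆ ⊤ - u
      N[u]⊆⊤-u z∈N[u] = x∈p∧x≢y⇒x∈p-y ∈⊤ (Adj⇒≢ (∈neighbours⁻ z∈N[u]) ∘ sym)

    single-edge⇒NC≐Δ : (∀ {y} → Adj G w y → y ≡ u) → (∀ {x} → Adj G u x → x ≡ w) → NC G ≐ Δ (⊤ - u - w)
    single-edge⇒NC≐Δ only-u only-w =
        (λ nc → let u∉τ , w∉τ = endpoints (NC⇒UncoveredEdge nc) in p⊆q-x⁺ (p⊆q-x⁺ ⊆⊤ u∉τ) w∉τ)
      , (λ τ⊆ → let τ⊆⊤-u , w∉τ = p⊆q-x⁻ τ⊆ in UncoveredEdge⇒NC (u , w , u~w , proj₂ (p⊆q-x⁻ τ⊆⊤-u) , w∉τ))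
      where
      endpoints : ∀ {τ} → UncoveredEdge τ → u ∉ τ × w ∉ τ
      endpoints (a , b , a~b , a∉τ , b∉τ) with cover a b a~b
      ... | inj₁ a∈uw with x∈⁅y⁆∪⁅z⁆⁻ a∈uw
      ...   | inj₁ refl = a∉τ , subst (_∉ _) (only-w a~b) b∉τ
      ...   | inj₂ refl = subst (_∉ _) (only-u a~b) b∉τ , a∉τ
      endpoints (a , b , a~b , a∉τ , b∉τ) | inj₂ b∈uw with x∈⁅y⁆∪⁅z⁆⁻ b∈uw
      ...   | inj₁ refl = b∉τ , subst (_∉ _) (only-w (Adj-sym a~b)) a∉τ
      ...   | inj₂ refl = subst (_∉ _) (only-u (Adj-sym a~b)) a∉τ , b∉τ

  coveringEdge⇒VertexDecomposable : ∀ {u w} → Adj G u w → IsCover G (⁅ u ⁆ ∪ ⁅ w ⁆) →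
                                    VertexDecomposable (NC G)
  coveringEdge⇒VertexDecomposable {u} {w} u~w cover with any? (λ y → Adj? w y ×-dec ¬? (y ≟ u))
  ... | yes (y , w~y , y≢u) = shed-u-vertexDecomposable u~w cover w~y y≢u
  ... | no ¬other-w with any? (λ x → Adj? u x ×-dec ¬? (x ≟ w))
  ...   | yes (x , u~x , x≢w) =
    shed-u-vertexDecomposable (Adj-sym u~w) (subst (IsCover G) (∪-comm ⁅ u ⁆ ⁅ w ⁆) cover) u~x x≢w
  ...   | no ¬other-u = VertexDecomposable-resp-≐ (≐-sym (single-edge⇒NC≐Δ u~w cover only-u only-w))
                          (Δ-vertexDecomposable (⊤ - u - w))
    where
    only-u : ∀ {y} → Adj G w y → y ≡ u
    only-u {y} w~y = decidable-stable (y ≟ u) (λ y≢u → ¬other-w (y , w~y , y≢u))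
    only-w : ∀ {x} → Adj G u x → x ≡ w
    only-w {x} u~x = decidable-stable (x ≟ w) (λ x≢w → ¬other-u (x , u~x , x≢w))

theorem4p5 : (n : ℕ) (G : Graph (suc n)) → IsForest G → NoIsolatedVertex G
    → VertexDecomposable (NC G) ⇔ (Connected G × ∣ internalVertices G ∣ ≤ 2)
theorem4p5 n G forest no-isolated = mk⇔
  (λ vd → let free = VertexDecomposable⇒2K₂Free G vd
          in 2K₂Free⇒Connected G free no-isolated , 2K₂Free⇒∣internalVertices∣≤2 G forest free)
  (λ (connected , ∣I∣≤2) →
     let _ , _ , u~w , cover = ∣internalVertices∣≤2⇒coveringEdge G connected no-isolated ∣I∣≤2 zero
     in coveringEdge⇒VertexDecomposable G u~w cover)
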